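{- For $N\in\mathbb{N}$, \begin{align*} &\sum_{n=1}^{N}\left[\begin{matrix} N \\ n\end{matrix}\right] \frac{(q)_n\left(\frac{b}{a}\right)_n\left(\frac{c}{d}\right)_n(ad)_{N-n}(ad)^n}{(b)_n(cq)_n(ad)_{N}}\\ &=\frac{(a-b)(d-c)}{(ad-b)}\sum_{n=1}^{N} \left[\begin{matrix} N \\ n\end{matrix}\right]\frac{(a)_{n-1}\left(\frac{bd}{c}\right)_{n-1}(q)_n\left(cq\right)_{N-n} c^{n-1}}{(b)_{n-1}(cq)_N(ad)_{n-1}}\left(\frac{adq^{n-1}}{1-adq^{n-1}} - \frac{bq^{n-1}}{1-bq^{n-1}}\right). \end{align*}
   Context: Throughout, $q\in\mathbb{C}$ with $|q|<1$; $(a)_0=(a;q)_0=1$, $(a)_n=(a;q)_n=(1-a)(1-aq)\cdots(1-aq^{n-1})$ for $n\ge1$, $(a)_\infty=\lim_{n\to\infty}(a)_n$. The $q$-binomial coefficient is $\left[\begin{matrix} N \\ n\end{matrix}\right]=\frac{(q)_N}{(q)_n(q)_{N-n}}$ for $0\le n\le N$ and $0$ otherwise. The parameters $a,b,c,d$ are complex numbers for which all denominators are nonzero. -}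

module Defs where

open import Level using (_⊔_) renaming (suc to lsuc)
open import Algebra.Bundles using (CommutativeRing)
open import Data.Nat using (ℕ; zero; suc; _∸_; _≤?_)
open import Relation.Nullary using (¬_; yes; no)

-- A field: a commutative ring with 0 ≠ 1 and a (total) inverse operation
-- that is a two-sided multiplicative inverse on every nonzero element.
-- (Its value at 0 is unspecified and never used under the hypotheses.)
record Field (c ℓ : Level.Level) : Set (lsuc (c ⊔ ℓ)) where
  field
    commutativeRing : CommutativeRing c ℓ
  open CommutativeRing commutativeRing public
  field
    _⁻¹       : Carrier → Carrier
    ⁻¹-inverse : ∀ x → ¬ (x ≈ 0#) → x * (x ⁻¹) ≈ 1#
    0≉1       : ¬ (0# ≈ 1#)

module FieldDefs {c ℓ} (F : Field c ℓ) where
  open Field F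

  infixl 7 _/_

  _/_ : Carrier → Carrier → Carrier
  x / y = x * (y ⁻¹)

  pow : Carrier → ℕ → Carrier
  pow x zero    = 1#
  pow x (suc n) = pow x n * x

  poch : (q x : Carrier) → ℕ → Carrier
  poch q x zero    = 1#
  poch q x (suc n) = poch q x n * (1# - x * pow q n)

  qbinom : (q : Carrier) → ℕ → ℕ → Carrier
  qbinom q N n with n ≤? N
  ... | yes _ = poch q q N / (poch q q n * poch q q (N ∸ n))
  ... | no  _ = 0#

  sum1 : ℕ → (ℕ → Carrier) → Carrier
  sum1 zero    f = 0#
  sum1 (suc N) f = sum1 N f + f (suc N)

{-# OPTIONS --safe #-}
module Submission where

-- Both sides S_N(a,b) satisfy the same first-order recurrence in N,
--   S_N(a,b) = t_N + K_N · S_{N-1}(aq,bq),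
--   t_N = (a-b)(d-c)(1-q^N) / ((1-b)(1-cq^N)(1-ad)),
--   K_N = (1-q^N)(1-a)(1-w)c / ((1-b)(1-cq^N)(1-ad)),
-- where u = b/a, v = c/d and w = bd/c are preserved by (a,b,w) ↦ (aq,bq,wq); induction on N
-- from S_0 = 0 then proves the identity.  On the right the recurrence is an index shift: the
-- first term is t_N and the (n+1)-st term is K_N times the n-th term of S_{N-1}(aq,bq).  On the
-- left, writing ℓ_n and ℓ'_n for the n-th terms of S_N(a,b) and S_{N-1}(aq,bq), the differences
-- ℓ_n - K_N ℓ'_n telescope as G(n-1) - G(n) for the certificate
--   G(j) = ℓ_j · ad(1-q^{N-j})(1-uq^j)(1-vq^j) / ((1-bq^j)(1-cq^N)(1-ad)),
-- which vanishes at j = N and equals t_N at j = 0.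

open import Defs
open import Level using (Level)
open import Data.Nat using (ℕ; _∸_)
open import Relation.Nullary using (¬_)

open import Algebra.Bundles using (CommutativeRing)
open import Data.Bool using (T)
open import Data.Integer as ℤ using (ℤ; +_; -[1+_]; +0; +[1+_])
import Data.Integer.Properties as ℤₚ
open import Data.Maybe using (nothing)
open import Data.Nat as ℕ using (zero; suc; _≤_; _<_; z≤n; s≤s; _≤′_; ≤′-step; ≤′-reflexive; _≤?_)
import Data.Nat.Properties as ℕₚ
open import Data.Product as Product using (proj₁; proj₂; _,_)
open import Data.Sign as Sign using (Sign)
open import Data.Sum using (inj₁; inj₂)
open import Data.Vec using (Vec)
open import Data.Vec.N-ary using (N-ary; Eq; Eqʰ; curryⁿ)
open import Function using (_⟨_⟩_)
open import Relation.Nullary using (isYes; yes; no)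
open import Relation.Nullary.Decidable using (toWitness)
open import Relation.Nullary.Negation using (contradiction)
open import Relation.Binary.PropositionalEquality as ≡ using (_≡_)
open import Tactic.RingSolver.Core.AlmostCommutativeRing using (AlmostCommutativeRing; fromCommutativeRing)
open import Tactic.RingSolver.Core.Polynomial.Parameters using (Homomorphism)
open import Tactic.RingSolver.Core.Expression using (Expr; Κ; Ι; _⊕_; _⊗_; ⊝_; _⊛_; module Eval)

-- With the carrier itself as coefficient ring, normalisation cannot recognise cancellations
-- such as 1 - 1 = 0 (there is no decidable equality), so constants are taken in ℤ and
-- interpreted through n ↦ n × 1#.
module ℤ-CoefficientRingSolver {c ℓ} (R : CommutativeRing c ℓ) where
  open CommutativeRing R
  open import Relation.Binary.Reasoning.Setoid setoid
  open import Algebra.Properties.Semiring.Mult.TCOptimised semiring using (_×_; ×-homo-+; ×1-homo-*)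
  open import Algebra.Properties.Ring ring using (-1*x≈-x; -‿distribʳ-*)
  open import Algebra.Properties.AbelianGroup +-abelianGroup using (⁻¹-∙-comm)
  open import Algebra.Properties.Group +-group using (ε⁻¹≈ε; ⁻¹-involutive)
  import Algebra.Properties.Semiring.Exp.TCOptimised semiring as Exp

  ⟦_⟧ℤ : ℤ → Carrier
  ⟦ + n ⟧ℤ      = n × 1#
  ⟦ -[1+ n ] ⟧ℤ = - (suc n × 1#)

  +-cancel-− : ∀ x y z → (x + y) - (x + z) ≈ y - z
  +-cancel-− x y z = begin
    (x + y) - (x + z)     ≈⟨ +-congˡ (sym (⁻¹-∙-comm x z)) ⟩
    (x + y) + (- x - z)   ≈⟨ +-assoc x y _ ⟩
    x + (y + (- x - z))   ≈⟨ +-congˡ (sym (+-assoc y _ _)) ⟩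
    x + ((y - x) - z)     ≈⟨ +-congˡ (+-congʳ (+-comm y _)) ⟩
    x + ((- x + y) - z)   ≈⟨ +-congˡ (+-assoc _ _ _) ⟩
    x + (- x + (y - z))   ≈⟨ sym (+-assoc _ _ _) ⟩
    (x - x) + (y - z)     ≈⟨ +-congʳ (-‿inverseʳ x) ⟩
    0# + (y - z)          ≈⟨ +-identityˡ _ ⟩
    y - z                 ∎

  x-0≈x : ∀ x → x - 0# ≈ x
  x-0≈x x = trans (+-congˡ ε⁻¹≈ε) (+-identityʳ x)

  ⊖-homo : ∀ m n → ⟦ m ℤ.⊖ n ⟧ℤ ≈ m × 1# - n × 1#
  ⊖-homo zero    zero    = sym (x-0≈x _)
  ⊖-homo (suc m) zero    = sym (x-0≈x _)
  ⊖-homo zero    (suc n) = sym (+-identityˡ _)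
  ⊖-homo (suc m) (suc n) = begin
    ⟦ suc m ℤ.⊖ suc n ⟧ℤ           ≡⟨ ≡.cong ⟦_⟧ℤ (ℤₚ.[1+m]⊖[1+n]≡m⊖n m n) ⟩
    ⟦ m ℤ.⊖ n ⟧ℤ                   ≈⟨ ⊖-homo m n ⟩
    m × 1# - n × 1#                ≈⟨ sym (+-cancel-− 1# _ _) ⟩
    (1# + m × 1#) - (1# + n × 1#)  ≈⟨ sym (+-cong (×-homo-+ 1# 1 m) (-‿cong (×-homo-+ 1# 1 n))) ⟩
    suc m × 1# - suc n × 1#        ∎

  -‿homo : ∀ i → ⟦ ℤ.- i ⟧ℤ ≈ - ⟦ i ⟧ℤ
  -‿homo -[1+ n ] = sym (⁻¹-involutive _)
  -‿homo +0       = sym ε⁻¹≈ε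
  -‿homo +[1+ n ] = refl

  +-homo : ∀ i j → ⟦ i ℤ.+ j ⟧ℤ ≈ ⟦ i ⟧ℤ + ⟦ j ⟧ℤ
  +-homo -[1+ m ] -[1+ n ] = begin
    - (suc (suc (m ℕ.+ n)) × 1#)      ≡⟨ ≡.cong (λ k → - (suc k × 1#)) (≡.sym (ℕₚ.+-suc m n)) ⟩
    - ((suc m ℕ.+ suc n) × 1#)        ≈⟨ -‿cong (×-homo-+ 1# (suc m) (suc n)) ⟩
    - (suc m × 1# + suc n × 1#)       ≈⟨ sym (⁻¹-∙-comm _ _) ⟩
    - (suc m × 1#) - (suc n × 1#)     ∎
  +-homo -[1+ m ] (+ n)    = trans (⊖-homo n (suc m)) (+-comm _ _)
  +-homo (+ m)    -[1+ n ] = ⊖-homo m (suc n)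
  +-homo (+ m)    (+ n)    = ×-homo-+ 1# m n

  ⟦_⟧± : Sign → Carrier
  ⟦ Sign.+ ⟧± = 1#
  ⟦ Sign.- ⟧± = - 1#

  ◃-homo : ∀ s n → ⟦ s ℤ.◃ n ⟧ℤ ≈ ⟦ s ⟧± * n × 1#
  ◃-homo s      zero    = sym (zeroʳ _)
  ◃-homo Sign.+ (suc n) = sym (*-identityˡ _)
  ◃-homo Sign.- (suc n) = sym (-1*x≈-x _)

  sign-*-homo : ∀ s t → ⟦ s Sign.* t ⟧± ≈ ⟦ s ⟧± * ⟦ t ⟧±
  sign-*-homo Sign.+ Sign.+ = sym (*-identityˡ _)
  sign-*-homo Sign.+ Sign.- = sym (*-identityˡ _)
  sign-*-homo Sign.- Sign.+ = sym (*-identityʳ _)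
  sign-*-homo Sign.- Sign.- = begin
    1#             ≈⟨ sym (⁻¹-involutive _) ⟩
    - - 1#         ≈⟨ -‿cong (sym (-1*x≈-x _)) ⟩
    - (- 1# * 1#)  ≈⟨ -‿distribʳ-* _ _ ⟩
    - 1# * - 1#    ∎

  ⟦⟧ℤ-sign-abs : ∀ i → ⟦ i ⟧ℤ ≈ ⟦ ℤ.sign i ⟧± * ℤ.∣ i ∣ × 1#
  ⟦⟧ℤ-sign-abs i = trans (reflexive (≡.cong ⟦_⟧ℤ (≡.sym (ℤₚ.◃-inverse i)))) (◃-homo (ℤ.sign i) ℤ.∣ i ∣)

  *-interchange : ∀ w x y z → (w * x) * (y * z) ≈ (w * y) * (x * z)
  *-interchange w x y z = begin
    (w * x) * (y * z)  ≈⟨ *-assoc w x _ ⟩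
    w * (x * (y * z))  ≈⟨ *-congˡ (sym (*-assoc x y z)) ⟩
    w * ((x * y) * z)  ≈⟨ *-congˡ (*-congʳ (*-comm x y)) ⟩
    w * ((y * x) * z)  ≈⟨ *-congˡ (*-assoc y x z) ⟩
    w * (y * (x * z))  ≈⟨ sym (*-assoc w y _) ⟩
    (w * y) * (x * z)  ∎

  *-homo : ∀ i j → ⟦ i ℤ.* j ⟧ℤ ≈ ⟦ i ⟧ℤ * ⟦ j ⟧ℤ
  *-homo i j = begin
    ⟦ (s Sign.* t) ℤ.◃ (m ℕ.* n) ⟧ℤ        ≈⟨ ◃-homo (s Sign.* t) (m ℕ.* n) ⟩
    ⟦ s Sign.* t ⟧± * (m ℕ.* n) × 1#       ≈⟨ *-cong (sign-*-homo s t) (×1-homo-* m n) ⟩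
    (⟦ s ⟧± * ⟦ t ⟧±) * (m × 1# * n × 1#)  ≈⟨ *-interchange _ _ _ _ ⟩
    (⟦ s ⟧± * m × 1#) * (⟦ t ⟧± * n × 1#)  ≈⟨ sym (*-cong (⟦⟧ℤ-sign-abs i) (⟦⟧ℤ-sign-abs j)) ⟩
    ⟦ i ⟧ℤ * ⟦ j ⟧ℤ                        ∎
    where
    s = ℤ.sign i
    t = ℤ.sign j
    m = ℤ.∣ i ∣
    n = ℤ.∣ j ∣

  homomorphism : Homomorphism _ _ _ _
  homomorphism = record
    { from = record { rawRing = ℤ.+-*-rawRing ; isZero = λ i → isYes (i ℤ.≟ ℤ.0ℤ) }
    ; to = fromCommutativeRing R (λ _ → nothing)
    ; morphism = record
      { ⟦_⟧ = ⟦_⟧ℤ ; +-homo = +-homo ; *-homo = *-homo ; -‿homo = -‿homo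
      ; 0-homo = refl ; 1-homo = refl }
    ; Zero-C⟶Zero-R = zero-homo
    }
    where
    zero-homo : ∀ i → T (isYes (i ℤ.≟ ℤ.0ℤ)) → 0# ≈ ⟦ i ⟧ℤ
    zero-homo i t with toWitness {a? = i ℤ.≟ ℤ.0ℤ} t
    ... | ≡.refl = refl

  module Ops where
    open import Tactic.RingSolver.Core.Polynomial.Base (Homomorphism.from homomorphism)
    open import Tactic.RingSolver.Core.Polynomial.Semantics homomorphism renaming (⟦_⟧ to ⟦_⟧ₚ)
    open import Tactic.RingSolver.Core.Polynomial.Homomorphism homomorphism
    open Eval (AlmostCommutativeRing.rawRing (Homomorphism.to homomorphism)) ⟦_⟧ℤ public

    norm : ∀ {n} → Expr ℤ n → Poly n
    norm (Κ x)   = κ x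
    norm (Ι x)   = ι x
    norm (x ⊕ y) = norm x ⊞ norm y
    norm (x ⊗ y) = norm x ⊠ norm y
    norm (⊝ x)   = ⊟ norm x
    norm (x ⊛ i) = norm x ⊡ i

    ⟦_⇓⟧ : ∀ {n} → Expr ℤ n → Vec Carrier n → Carrier
    ⟦ e ⇓⟧ = ⟦ norm e ⟧ₚ

    correct : ∀ {n} (e : Expr ℤ n) ρ → ⟦ e ⇓⟧ ρ ≈ ⟦ e ⟧ ρ
    correct (Κ x)   ρ = κ-hom x ρ
    correct (Ι x)   ρ = ι-hom x ρ
    correct (x ⊕ y) ρ = ⊞-hom (norm x) (norm y) ρ ⟨ trans ⟩ +-cong (correct x ρ) (correct y ρ)
    correct (x ⊗ y) ρ = ⊠-hom (norm x) (norm y) ρ ⟨ trans ⟩ *-cong (correct x ρ) (correct y ρ)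
    correct (⊝ x)   ρ = ⊟-hom (norm x) ρ ⟨ trans ⟩ -‿cong (correct x ρ)
    correct (x ⊛ i) ρ = ⊡-hom (norm x) i ρ ⟨ trans ⟩ Exp.^-congˡ i (correct x ρ)

    open import Relation.Binary.Reflection setoid Ι ⟦_⟧ ⟦_⇓⟧ correct public

  solve : ∀ (n : ℕ) →
          (f : N-ary n (Expr ℤ n) (Expr ℤ n Product.× Expr ℤ n)) →
          Eqʰ n _≈_ (curryⁿ (Ops.⟦_⇓⟧ (proj₁ (Ops.close n f)))) (curryⁿ (Ops.⟦_⇓⟧ (proj₂ (Ops.close n f)))) →
          Eq  n _≈_ (curryⁿ (Ops.⟦_⟧  (proj₁ (Ops.close n f)))) (curryⁿ (Ops.⟦_⟧  (proj₂ (Ops.close n f))))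
  solve = Ops.solve

  infix 4 _⊜_
  _⊜_ : ∀ {n} → Expr ℤ n → Expr ℤ n → Expr ℤ n Product.× Expr ℤ n
  _⊜_ = _,_

  infixl 6 _⊖_
  _⊖_ : ∀ {n} → Expr ℤ n → Expr ℤ n → Expr ℤ n
  x ⊖ y = x ⊕ ⊝ y

  𝟏 : ∀ {n} → Expr ℤ n
  𝟏 = Κ (+ 1)


module FieldProperties {ℓc ℓe} (F : Field ℓc ℓe) where
  open Field F
  open FieldDefs F
  open ℤ-CoefficientRingSolver commutativeRing
  open import Relation.Binary.Reasoning.Setoid setoid

  ≉0-resp-≈ : ∀ {x y} → x ≈ y → x ≉ 0# → y ≉ 0#
  ≉0-resp-≈ x≈y x≉0 y≈0 = x≉0 (trans x≈y y≈0)

  *≉0⇒≉0ˡ : ∀ {x y} → x * y ≉ 0# → x ≉ 0#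
  *≉0⇒≉0ˡ {x} {y} xy≉0 x≈0 = xy≉0 (trans (*-congʳ x≈0) (zeroˡ y))

  *≉0⇒≉0ʳ : ∀ {x y} → x * y ≉ 0# → y ≉ 0#
  *≉0⇒≉0ʳ {x} {y} xy≉0 y≈0 = xy≉0 (trans (*-congˡ y≈0) (zeroʳ x))

  ⁻¹-inverseˡ : ∀ x → x ≉ 0# → x ⁻¹ * x ≈ 1#
  ⁻¹-inverseˡ x x≉0 = trans (*-comm _ _) (⁻¹-inverse x x≉0)

  *-≉0 : ∀ {x y} → x ≉ 0# → y ≉ 0# → x * y ≉ 0#
  *-≉0 {x} {y} x≉0 y≉0 xy≈0 = y≉0 (begin
    y                ≈⟨ sym (*-identityˡ y) ⟩
    1# * y           ≈⟨ *-congʳ (sym (⁻¹-inverseˡ x x≉0)) ⟩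
    (x ⁻¹ * x) * y   ≈⟨ *-assoc _ _ _ ⟩
    x ⁻¹ * (x * y)   ≈⟨ *-congˡ xy≈0 ⟩
    x ⁻¹ * 0#        ≈⟨ zeroʳ _ ⟩
    0#               ∎)

  ⁻¹-distrib-* : ∀ {x y} → x ≉ 0# → y ≉ 0# → (x * y) ⁻¹ ≈ x ⁻¹ * y ⁻¹
  ⁻¹-distrib-* {x} {y} x≉0 y≉0 = begin
    (x * y) ⁻¹                                 ≈⟨ sym (*-identityʳ _) ⟩
    (x * y) ⁻¹ * 1#                            ≈⟨ *-congˡ (sym xy*x⁻¹y⁻¹≈1) ⟩
    (x * y) ⁻¹ * ((x * y) * (x ⁻¹ * y ⁻¹))     ≈⟨ sym (*-assoc _ _ _) ⟩
    ((x * y) ⁻¹ * (x * y)) * (x ⁻¹ * y ⁻¹)     ≈⟨ *-congʳ (⁻¹-inverseˡ _ (*-≉0 x≉0 y≉0)) ⟩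
    1# * (x ⁻¹ * y ⁻¹)                         ≈⟨ *-identityˡ _ ⟩
    x ⁻¹ * y ⁻¹                                ∎
    where
    xy*x⁻¹y⁻¹≈1 : (x * y) * (x ⁻¹ * y ⁻¹) ≈ 1#
    xy*x⁻¹y⁻¹≈1 = begin
      (x * y) * (x ⁻¹ * y ⁻¹)    ≈⟨ *-interchange x y _ _ ⟩
      (x * x ⁻¹) * (y * y ⁻¹)    ≈⟨ *-cong (⁻¹-inverse x x≉0) (⁻¹-inverse y y≉0) ⟩
      1# * 1#                    ≈⟨ *-identityʳ 1# ⟩
      1#                         ∎

  /-cancelʳ : ∀ x {y} → y ≉ 0# → x / y * y ≈ x
  /-cancelʳ x {y} y≉0 = trans (*-assoc _ _ _) (trans (*-congˡ (⁻¹-inverseˡ y y≉0)) (*-identityʳ x))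

  /-cancelˡ : ∀ x {y} → y ≉ 0# → x * y / y ≈ x
  /-cancelˡ x {y} y≉0 = trans (*-assoc _ _ _) (trans (*-congˡ (⁻¹-inverse y y≉0)) (*-identityʳ x))

  *≈⇒≈/ : ∀ {x y z} → y ≉ 0# → x * y ≈ z → x ≈ z / y
  *≈⇒≈/ {x} {y} {z} y≉0 xy≈z = trans (sym (/-cancelˡ x y≉0)) (*-congʳ xy≈z)

  x/x≈1 : ∀ {x y} → y ≉ 0# → x ≈ y → x / y ≈ 1#
  x/x≈1 {y = y} y≉0 x≈y = trans (*-congʳ x≈y) (⁻¹-inverse y y≉0)

  /-cross : ∀ {x y z w} → y ≉ 0# → w ≉ 0# → x * w ≈ z * y → x / y ≈ z / w
  /-cross {x} {y} {z} {w} y≉0 w≉0 xw≈zy = begin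
    x / y              ≈⟨ sym (/-cancelˡ _ w≉0) ⟩
    x / y * w / w      ≈⟨ *-congʳ (solve 3 (λ x i w → x ⊗ i ⊗ w ⊜ x ⊗ w ⊗ i) refl x (y ⁻¹) w) ⟩
    x * w / y / w      ≈⟨ *-congʳ (*-congʳ xw≈zy) ⟩
    z * y / y / w      ≈⟨ *-congʳ (/-cancelˡ z y≉0) ⟩
    z / w              ∎

  /-*-cross : ∀ {x y s z w t} → y ≉ 0# → w ≉ 0# → x * s * w ≈ z * t * y → x / y * s ≈ z / w * t
  /-*-cross {x} {y} {s} {z} {w} {t} y≉0 w≉0 eq = begin
    x / y * s        ≈⟨ solve 3 (λ x i s → x ⊗ i ⊗ s ⊜ x ⊗ s ⊗ i) refl x (y ⁻¹) s ⟩
    x * s / y        ≈⟨ /-cross y≉0 w≉0 eq ⟩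
    z * t / w        ≈⟨ solve 3 (λ z j t → z ⊗ t ⊗ j ⊜ z ⊗ j ⊗ t) refl z (w ⁻¹) t ⟩
    z / w * t        ∎

  /-*-/ : ∀ x {y} z {w} → y ≉ 0# → w ≉ 0# → x / y * z / w ≈ (x * z) / (y * w)
  /-*-/ x {y} z {w} y≉0 w≉0 = begin
    x / y * z / w
      ≈⟨ solve 4 (λ x i z j → x ⊗ i ⊗ z ⊗ j ⊜ (x ⊗ z) ⊗ (i ⊗ j)) refl x (y ⁻¹) z (w ⁻¹) ⟩
    (x * z) * (y ⁻¹ * w ⁻¹)
      ≈⟨ *-congˡ (sym (⁻¹-distrib-* y≉0 w≉0)) ⟩
    (x * z) / (y * w)
      ∎

  /-+-/ : ∀ x {y} z {w} → y ≉ 0# → w ≉ 0# → x / y + z / w ≈ (x * w + z * y) / (y * w)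
  /-+-/ x {y} z {w} y≉0 w≉0 = begin
    x / y + z / w
      ≈⟨ sym (+-cong (/-cancelˡ _ w≉0) (/-cancelˡ _ y≉0)) ⟩
    x / y * w / w + z / w * y / y
      ≈⟨ solve 6 (λ x i w j z y → x ⊗ i ⊗ w ⊗ j ⊕ z ⊗ j ⊗ y ⊗ i ⊜ (x ⊗ w ⊕ z ⊗ y) ⊗ (i ⊗ j))
           refl x (y ⁻¹) w (w ⁻¹) z y ⟩
    (x * w + z * y) * (y ⁻¹ * w ⁻¹)
      ≈⟨ *-congˡ (sym (⁻¹-distrib-* y≉0 w≉0)) ⟩
    (x * w + z * y) / (y * w)
      ∎

  /---/ : ∀ x {y} z {w} → y ≉ 0# → w ≉ 0# → x / y - z / w ≈ (x * w - z * y) / (y * w)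
  /---/ x {y} z {w} y≉0 w≉0 = begin
    x / y - z / w
      ≈⟨ solve 4 (λ x i z j → x ⊗ i ⊖ z ⊗ j ⊜ x ⊗ i ⊕ (⊝ z) ⊗ j) refl x (y ⁻¹) z (w ⁻¹) ⟩
    x / y + (- z) / w
      ≈⟨ /-+-/ x (- z) y≉0 w≉0 ⟩
    (x * w + (- z) * y) / (y * w)
      ≈⟨ *-congʳ (solve 4 (λ x w z y → x ⊗ w ⊕ (⊝ z) ⊗ y ⊜ x ⊗ w ⊖ z ⊗ y) refl x w z y) ⟩
    (x * w - z * y) / (y * w)
      ∎

  x-x*r/y : ∀ x r {y} → y ≉ 0# → x - x * r / y ≈ x * (y - r) / y
  x-x*r/y x r {y} y≉0 = begin
    x - x * r / y
      ≈⟨ +-congʳ (sym (/-cancelˡ x y≉0)) ⟩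
    x * y / y - x * r / y
      ≈⟨ solve 4 (λ x y r i → x ⊗ y ⊗ i ⊖ x ⊗ r ⊗ i ⊜ x ⊗ (y ⊖ r) ⊗ i) refl x y r (y ⁻¹) ⟩
    x * (y - r) / y
      ∎

  x[yz-w]/zv≈xy/v-xw/zv : ∀ x y w {z v} → z ≉ 0# → v ≉ 0# →
    x * (y * z - w) / (z * v) ≈ x * y / v - x * w / (z * v)
  x[yz-w]/zv≈xy/v-xw/zv x y w {z} {v} z≉0 v≉0 = sym (begin
    x * y / v - x * w / (z * v)
      ≈⟨ +-congʳ (/-cross v≉0 (*-≉0 z≉0 v≉0)
                   (solve 4 (λ x y z v → x ⊗ y ⊗ (z ⊗ v) ⊜ x ⊗ y ⊗ z ⊗ v) refl x y z v)) ⟩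
    x * y * z / (z * v) - x * w / (z * v)
      ≈⟨ solve 5 (λ x y z w i → x ⊗ y ⊗ z ⊗ i ⊖ x ⊗ w ⊗ i ⊜ x ⊗ (y ⊗ z ⊖ w) ⊗ i) refl x y z w ((z * v) ⁻¹) ⟩
    x * (y * z - w) / (z * v)
      ∎)

module PochhammerProperties {ℓc ℓe} (F : Field ℓc ℓe) where
  open Field F
  open FieldDefs F
  open ℤ-CoefficientRingSolver commutativeRing
  open FieldProperties F
  open import Relation.Binary.Reasoning.Setoid setoid

  pow-+ : ∀ x m n → pow x (m ℕ.+ n) ≈ pow x m * pow x n
  pow-+ x zero    n = sym (*-identityˡ _)
  pow-+ x (suc m) n = begin
    pow x (m ℕ.+ n) * x       ≈⟨ *-congʳ (pow-+ x m n) ⟩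
    pow x m * pow x n * x     ≈⟨ solve 3 (λ a b x → a ⊗ b ⊗ x ⊜ a ⊗ x ⊗ b) refl _ _ x ⟩
    pow x m * x * pow x n     ∎

  pow-distrib-* : ∀ x y n → pow (x * y) n ≈ pow x n * pow y n
  pow-distrib-* x y zero    = sym (*-identityˡ _)
  pow-distrib-* x y (suc n) = trans (*-congʳ (pow-distrib-* x y n)) (*-interchange _ _ x y)

  poch-unfoldˡ : ∀ q x n → poch q x (suc n) ≈ (1# - x) * poch q (x * q) n
  poch-unfoldˡ q x zero    = solve 1 (λ x → 𝟏 ⊗ (𝟏 ⊖ x ⊗ 𝟏) ⊜ (𝟏 ⊖ x) ⊗ 𝟏) refl x
  poch-unfoldˡ q x (suc n) = begin
    poch q x (suc n) * (1# - x * (pow q n * q))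
      ≈⟨ *-congʳ (poch-unfoldˡ q x n) ⟩
    (1# - x) * poch q (x * q) n * (1# - x * (pow q n * q))
      ≈⟨ solve 4 (λ x p q y → (𝟏 ⊖ x) ⊗ p ⊗ (𝟏 ⊖ x ⊗ (y ⊗ q)) ⊜ (𝟏 ⊖ x) ⊗ (p ⊗ (𝟏 ⊖ x ⊗ q ⊗ y)))
           refl x _ q _ ⟩
    (1# - x) * (poch q (x * q) n * (1# - x * q * pow q n))
      ∎

  poch-≉0-≤′ : ∀ {q x n N} → n ≤′ N → poch q x N ≉ 0# → poch q x n ≉ 0#
  poch-≉0-≤′ (≤′-reflexive ≡.refl) pN≉0 = pN≉0
  poch-≉0-≤′ (≤′-step n≤′N)        pN≉0 = poch-≉0-≤′ n≤′N (*≉0⇒≉0ˡ pN≉0)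

  poch-≉0-≤ : ∀ {q x n N} → n ≤ N → poch q x N ≉ 0# → poch q x n ≉ 0#
  poch-≉0-≤ n≤N = poch-≉0-≤′ (ℕₚ.≤⇒≤′ n≤N)

  poch-factor-≉0 : ∀ {q x j N} → j < N → poch q x N ≉ 0# → 1# - x * pow q j ≉ 0#
  poch-factor-≉0 j<N pN≉0 = *≉0⇒≉0ʳ (poch-≉0-≤ j<N pN≉0)

  poch-first-≉0 : ∀ q x N → poch q x (suc N) ≉ 0# → 1# - x ≉ 0#
  poch-first-≉0 q x N pN≉0 = *≉0⇒≉0ˡ (≉0-resp-≈ (poch-unfoldˡ q x N) pN≉0)

  poch-shift-≉0 : ∀ q x N → poch q x (suc N) ≉ 0# → poch q (x * q) N ≉ 0#
  poch-shift-≉0 q x N pN≉0 = *≉0⇒≉0ʳ (≉0-resp-≈ (poch-unfoldˡ q x N) pN≉0)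

  qbinom-≤ : ∀ q {N n} → n ≤ N → qbinom q N n ≡ poch q q N / (poch q q n * poch q q (N ∸ n))
  qbinom-≤ q {N} {n} n≤N with n ≤? N
  ... | yes _   = ≡.refl
  ... | no  n≰N = contradiction n≤N n≰N

  qbinom-> : ∀ q {N n} → N < n → qbinom q N n ≡ 0#
  qbinom-> q {N} {n} N<n with n ≤? N
  ... | yes n≤N = contradiction N<n (ℕₚ.≤⇒≯ n≤N)
  ... | no  _   = ≡.refl

module Sum1Properties {ℓc ℓe} (F : Field ℓc ℓe) where
  open Field F
  open FieldDefs F
  open ℤ-CoefficientRingSolver commutativeRing

  sum1-cong : ∀ N {f g : ℕ → Carrier} → (∀ n → 1 ≤ n → n ≤ N → f n ≈ g n) → sum1 N f ≈ sum1 N g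
  sum1-cong zero    f≈g = refl
  sum1-cong (suc N) f≈g =
    +-cong (sum1-cong N (λ n 1≤n n≤N → f≈g n 1≤n (ℕₚ.m≤n⇒m≤1+n n≤N))) (f≈g (suc N) (s≤s z≤n) ℕₚ.≤-refl)

  sum1-unfoldˡ : ∀ N (f : ℕ → Carrier) → sum1 (suc N) f ≈ f 1 + sum1 N (λ n → f (suc n))
  sum1-unfoldˡ zero    f = trans (+-identityˡ _) (sym (+-identityʳ _))
  sum1-unfoldˡ (suc N) f = trans (+-congʳ (sum1-unfoldˡ N f)) (+-assoc _ _ _)

  *-distribˡ-sum1 : ∀ N x (f : ℕ → Carrier) → x * sum1 N f ≈ sum1 N (λ n → x * f n)
  *-distribˡ-sum1 zero    x f = zeroʳ x
  *-distribˡ-sum1 (suc N) x f = trans (distribˡ _ _ _) (+-congʳ (*-distribˡ-sum1 N x f))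

  sum1-− : ∀ N (f g : ℕ → Carrier) → sum1 N (λ n → f n - g n) ≈ sum1 N f - sum1 N g
  sum1-− zero    f g = sym (-‿inverseʳ 0#)
  sum1-− (suc N) f g = trans (+-congʳ (sum1-− N f g))
    (solve 4 (λ a b c d → (a ⊖ b) ⊕ (c ⊖ d) ⊜ (a ⊕ c) ⊖ (b ⊕ d)) refl _ _ _ _)

  sum1-telescope : ∀ N (h : ℕ → Carrier) → sum1 N (λ n → h (n ∸ 1) - h n) ≈ h 0 - h N
  sum1-telescope zero    h = sym (-‿inverseʳ (h 0))
  sum1-telescope (suc N) h = trans (+-congʳ (sum1-telescope N h))
    (solve 3 (λ a b c → (a ⊖ b) ⊕ (b ⊖ c) ⊜ a ⊖ c) refl _ _ _)

module Recurrence {ℓc ℓe} (F : Field ℓc ℓe) (q c d u v : Field.Carrier F) where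
  open Field F
  open FieldDefs F
  open ℤ-CoefficientRingSolver commutativeRing
  open FieldProperties F
  open PochhammerProperties F
  open Sum1Properties F
  open import Relation.Binary.Reasoning.Setoid setoid
  import Algebra.Solver.CommutativeMonoid *-commutativeMonoid as CM
  open CM using () renaming (_⊕_ to infixl 7 _⊙_; _⊜_ to infix 4 _≋_)

  Q : ℕ → Carrier
  Q = poch q q

  -- A stands for a d.  As a separate parameter it shifts to A q, so the shifted Pochhammer
  -- symbols are (A q; q)ₙ rather than the merely ≈-equal (a q d; q)ₙ.
  record Admissible (a b w A : Carrier) : Set ℓe where
    field
      ua≈b  : u * a ≈ b
      vd≈c  : v * d ≈ c
      wc≈bd : w * c ≈ b * d
      A≈ad  : A ≈ a * d

  record Nondegenerate (N : ℕ) (b A : Carrier) : Set ℓe where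
    field
      Q≉0  : Q N ≉ 0#
      b≉0  : poch q b N ≉ 0#
      cq≉0 : poch q (c * q) N ≉ 0#
      A≉0  : poch q A N ≉ 0#

  admissible-shift : ∀ {a b w A} → Admissible a b w A → Admissible (a * q) (b * q) (w * q) (A * q)
  admissible-shift {a} {b} {w} {A} adm = record
    { ua≈b  = trans (sym (*-assoc u a q)) (*-congʳ ua≈b)
    ; vd≈c  = vd≈c
    ; wc≈bd = begin
        w * q * c  ≈⟨ solve 3 (λ w q c → w ⊗ q ⊗ c ⊜ w ⊗ c ⊗ q) refl w q c ⟩
        w * c * q  ≈⟨ *-congʳ wc≈bd ⟩
        b * d * q  ≈⟨ solve 3 (λ b d q → b ⊗ d ⊗ q ⊜ b ⊗ q ⊗ d) refl b d q ⟩
        b * q * d  ∎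
    ; A≈ad  = trans (*-congʳ A≈ad) (solve 3 (λ a d q → a ⊗ d ⊗ q ⊜ a ⊗ q ⊗ d) refl a d q)
    }
    where open Admissible adm

  nondegenerate-shift : ∀ {M b A} → Nondegenerate (suc M) b A → Nondegenerate M (b * q) (A * q)
  nondegenerate-shift {M} {b} {A} nd = record
    { Q≉0  = *≉0⇒≉0ˡ Q≉0
    ; b≉0  = poch-shift-≉0 q b M b≉0
    ; cq≉0 = *≉0⇒≉0ˡ cq≉0
    ; A≉0  = poch-shift-≉0 q A M A≉0
    }
    where open Nondegenerate nd

  Δ : ℕ → Carrier → Carrier
  Δ N A = (1# - c * pow q N) * (1# - A)

  module _ {M b A} (nd : Nondegenerate (suc M) b A) where
    open Nondegenerate nd

    1-q^N≉0 : 1# - pow q (suc M) ≉ 0#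
    1-q^N≉0 = ≉0-resp-≈ (+-congˡ (-‿cong (*-comm q (pow q M)))) (*≉0⇒≉0ʳ Q≉0)

    1-b≉0 : 1# - b ≉ 0#
    1-b≉0 = poch-first-≉0 q b M b≉0

    Δ≉0 : Δ (suc M) A ≉ 0#
    Δ≉0 = *-≉0 1-cq^N≉0 (poch-first-≉0 q A M A≉0)
      where
      cqq^M≈cq^N = solve 3 (λ c q y → c ⊗ q ⊗ y ⊜ c ⊗ (y ⊗ q)) refl c q (pow q M)
      1-cq^N≉0 = ≉0-resp-≈ (+-congˡ (-‿cong cqq^M≈cq^N)) (*≉0⇒≉0ʳ cq≉0)

  lhsTerm : ℕ → Carrier → Carrier → ℕ → Carrier
  lhsTerm N b A n =
    qbinom q N n * (Q n * poch q u n * poch q v n * poch q A (N ∸ n) * pow A n)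
      / (poch q b n * poch q (c * q) n * poch q A N)

  -- In the next two lemmas m is N ∸ n; it is a separate argument so that callers can
  -- present it as a successor and let Q m and (A; q)ₘ unfold.
  lhsDenominator-≉0 : ∀ {N n m b A} → n ≤ N → N ∸ n ≡ m → Nondegenerate N b A →
    Q n * Q m * (poch q b n * poch q (c * q) n * poch q A N) ≉ 0#
  lhsDenominator-≉0 {N} {n} n≤N ≡.refl nd =
    *-≉0 (*-≉0 (poch-≉0-≤ n≤N Q≉0) (poch-≉0-≤ (ℕₚ.m∸n≤m N n) Q≉0))
         (*-≉0 (*-≉0 (poch-≉0-≤ n≤N b≉0) (poch-≉0-≤ n≤N cq≉0)) A≉0)
    where open Nondegenerate nd

  lhsTerm-normal : ∀ {N n m b A} → n ≤ N → N ∸ n ≡ m → Nondegenerate N b A →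
    lhsTerm N b A n ≈ Q N * (Q n * poch q u n * poch q v n * poch q A m * pow A n)
                        / (Q n * Q m * (poch q b n * poch q (c * q) n * poch q A N))
  lhsTerm-normal {N} {n} n≤N ≡.refl nd rewrite qbinom-≤ q n≤N =
    /-*-/ (Q N) _ (*≉0⇒≉0ˡ D≉0) (*≉0⇒≉0ʳ D≉0)
    where D≉0 = lhsDenominator-≉0 n≤N ≡.refl nd

  lhsTerm-zero : ∀ {N b A} → Nondegenerate N b A → lhsTerm N b A 0 ≈ 1#
  lhsTerm-zero {N} {b} {A} nd = trans (lhsTerm-normal z≤n ≡.refl nd)
    (x/x≈1 (lhsDenominator-≉0 z≤n ≡.refl nd)
      (solve 2 (λ QN AN → QN ⊗ (𝟏 ⊗ 𝟏 ⊗ 𝟏 ⊗ AN ⊗ 𝟏) ⊜ 𝟏 ⊗ QN ⊗ (𝟏 ⊗ 𝟏 ⊗ AN)) refl (Q N) (poch q A N)))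

  lhsTerm-out-of-range : ∀ M b A → lhsTerm M b A (suc M) ≈ 0#
  lhsTerm-out-of-range M b A rewrite qbinom-> q {M} {suc M} ℕₚ.≤-refl =
    trans (*-congʳ (zeroˡ _)) (zeroˡ _)

  lhsTerm-shift : ∀ {M k b A} → k < M → Nondegenerate (suc M) b A →
    lhsTerm M (b * q) (A * q) (suc k) * ((1# - pow q (suc M)) * (1# - b * pow q (suc k)))
    ≈ lhsTerm (suc M) b A (suc k) * (pow q (suc k) * (1# - pow q (M ∸ k)) * (1# - b))
  lhsTerm-shift {M} {k} {b} {A} k<M nd = begin
    lhsTerm M (b * q) (A * q) (suc k) * E  ≈⟨ *-congʳ (lhsTerm-normal k<M ≡.refl (nondegenerate-shift nd)) ⟩
    P₁ / D₁ * E                            ≈⟨ /-*-cross D₁≉0 D₂≉0 cross ⟩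
    P₂ / D₂ * s′                           ≈⟨ *-cong (sym (lhsTerm-normal (ℕₚ.m≤n⇒m≤1+n k<M) M∸k≡1+m nd)) s′≈s ⟩
    lhsTerm (suc M) b A (suc k) * s        ∎
    where
    m = M ∸ suc k
    M∸k≡1+m : M ∸ k ≡ suc m
    M∸k≡1+m = ℕₚ.+-∸-assoc 1 k<M
    E  = (1# - pow q (suc M)) * (1# - b * pow q (suc k))
    s  = pow q (suc k) * (1# - pow q (M ∸ k)) * (1# - b)
    s′ = pow q (suc k) * (1# - pow q (suc m)) * (1# - b)
    s′≈s : s′ ≈ s
    s′≈s = reflexive (≡.cong (λ j → pow q (suc k) * (1# - pow q j) * (1# - b)) (≡.sym M∸k≡1+m))
    P₁ = Q M * (Q (suc k) * poch q u (suc k) * poch q v (suc k) * poch q (A * q) m * pow (A * q) (suc k))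
    D₁ = Q (suc k) * Q m * (poch q (b * q) (suc k) * poch q (c * q) (suc k) * poch q (A * q) M)
    P₂ = Q (suc M) * (Q (suc k) * poch q u (suc k) * poch q v (suc k) * poch q A (suc m) * pow A (suc k))
    D₂ = Q (suc k) * Q (suc m) * (poch q b (suc k) * poch q (c * q) (suc k) * poch q A (suc M))
    P₁′ = Q M * (Q (suc k) * poch q u (suc k) * poch q v (suc k) * poch q (A * q) m
                   * (pow A (suc k) * pow q (suc k)))
    D₂′ = Q (suc k) * Q (suc m)
            * ((1# - b) * poch q (b * q) k * poch q (c * q) (suc k) * ((1# - A) * poch q (A * q) M))
    P₂′ = Q (suc M) * (Q (suc k) * poch q u (suc k) * poch q v (suc k) * ((1# - A) * poch q (A * q) m)
                         * pow A (suc k))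
    D₁≉0 = lhsDenominator-≉0 k<M ≡.refl (nondegenerate-shift nd)
    D₂≉0 = lhsDenominator-≉0 (ℕₚ.m≤n⇒m≤1+n k<M) M∸k≡1+m nd
    cross : P₁ * E * D₂ ≈ P₂ * s′ * D₁
    cross = begin
      P₁ * E * D₂
        ≈⟨ *-cong (*-congʳ (*-congˡ (*-congˡ (pow-distrib-* A q (suc k)))))
                  (*-congˡ (*-cong (*-congʳ (poch-unfoldˡ q b k)) (poch-unfoldˡ q A M))) ⟩
      P₁′ * E * D₂′
        ≈⟨ solve 17 (λ QM Qk U V Am An x Qm z Bk Cn AM y b q ob oA →
             QM ⊗ (Qk ⊗ U ⊗ V ⊗ Am ⊗ (An ⊗ (x ⊗ q))) ⊗ ((𝟏 ⊖ y ⊗ q) ⊗ (𝟏 ⊖ b ⊗ (x ⊗ q)))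
               ⊗ (Qk ⊗ (Qm ⊗ (𝟏 ⊖ q ⊗ z)) ⊗ (ob ⊗ Bk ⊗ Cn ⊗ (oA ⊗ AM)))
             ⊜ QM ⊗ (𝟏 ⊖ q ⊗ y) ⊗ (Qk ⊗ U ⊗ V ⊗ (oA ⊗ Am) ⊗ An) ⊗ ((x ⊗ q) ⊗ (𝟏 ⊖ z ⊗ q) ⊗ ob)
               ⊗ (Qk ⊗ Qm ⊗ (Bk ⊗ (𝟏 ⊖ b ⊗ q ⊗ x) ⊗ Cn ⊗ AM)))
           refl (Q M) (Q (suc k)) (poch q u (suc k)) (poch q v (suc k)) (poch q (A * q) m) (pow A (suc k))
                (pow q k) (Q m) (pow q m) (poch q (b * q) k) (poch q (c * q) (suc k)) (poch q (A * q) M)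
                (pow q M) b q (1# - b) (1# - A) ⟩
      P₂′ * s′ * D₁
        ≈⟨ *-congʳ (*-congʳ (*-congˡ (*-congʳ (*-congˡ (sym (poch-unfoldˡ q A m)))))) ⟩
      P₂ * s′ * D₁
        ∎

  lhsTerm-step : ∀ {M k b A} → k ≤ M → Nondegenerate (suc M) b A →
    lhsTerm (suc M) b A k * (A * (1# - pow q (suc M ∸ k)) * (1# - u * pow q k) * (1# - v * pow q k))
    ≈ lhsTerm (suc M) b A (suc k) * ((1# - A * pow q (M ∸ k)) * (1# - c * pow q (suc k)) * (1# - b * pow q k))
  lhsTerm-step {M} {k} {b} {A} k≤M nd = begin
    lhsTerm (suc M) b A k * s        ≈⟨ *-cong (lhsTerm-normal k≤1+M 1+M∸k≡1+m nd) s≈s′ ⟩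
    P₁ / D₁ * s′                     ≈⟨ /-*-cross (lhsDenominator-≉0 k≤1+M 1+M∸k≡1+m nd)
                                                  (lhsDenominator-≉0 (s≤s k≤M) ≡.refl nd) cross ⟩
    P₂ / D₂ * t                      ≈⟨ *-congʳ (sym (lhsTerm-normal (s≤s k≤M) ≡.refl nd)) ⟩
    lhsTerm (suc M) b A (suc k) * t  ∎
    where
    m = M ∸ k
    k≤1+M = ℕₚ.m≤n⇒m≤1+n k≤M
    1+M∸k≡1+m : suc M ∸ k ≡ suc m
    1+M∸k≡1+m = ℕₚ.+-∸-assoc 1 k≤M
    s  = A * (1# - pow q (suc M ∸ k)) * (1# - u * pow q k) * (1# - v * pow q k)
    s′ = A * (1# - pow q (suc m)) * (1# - u * pow q k) * (1# - v * pow q k)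
    t  = (1# - A * pow q m) * (1# - c * pow q (suc k)) * (1# - b * pow q k)
    s≈s′ : s ≈ s′
    s≈s′ = reflexive (≡.cong (λ j → A * (1# - pow q j) * (1# - u * pow q k) * (1# - v * pow q k)) 1+M∸k≡1+m)
    P₁ = Q (suc M) * (Q k * poch q u k * poch q v k * poch q A (suc m) * pow A k)
    D₁ = Q k * Q (suc m) * (poch q b k * poch q (c * q) k * poch q A (suc M))
    P₂ = Q (suc M) * (Q (suc k) * poch q u (suc k) * poch q v (suc k) * poch q A m * pow A (suc k))
    D₂ = Q (suc k) * Q m * (poch q b (suc k) * poch q (c * q) (suc k) * poch q A (suc M))
    cross : P₁ * s′ * D₂ ≈ P₂ * t * D₁
    cross = solve 20 (λ QN Qk Uk Vk Am Ak Qm Bk Ck AN A c q x z Az ux vx bx qx →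
        QN ⊗ (Qk ⊗ Uk ⊗ Vk ⊗ (Am ⊗ Az) ⊗ Ak) ⊗ (A ⊗ (𝟏 ⊖ z ⊗ q) ⊗ ux ⊗ vx)
          ⊗ (Qk ⊗ qx ⊗ Qm ⊗ (Bk ⊗ bx ⊗ (Ck ⊗ (𝟏 ⊖ c ⊗ q ⊗ x)) ⊗ AN))
        ⊜ QN ⊗ (Qk ⊗ qx ⊗ (Uk ⊗ ux) ⊗ (Vk ⊗ vx) ⊗ Am ⊗ (Ak ⊗ A)) ⊗ (Az ⊗ (𝟏 ⊖ c ⊗ (x ⊗ q)) ⊗ bx)
          ⊗ (Qk ⊗ (Qm ⊗ (𝟏 ⊖ q ⊗ z)) ⊗ (Bk ⊗ Ck ⊗ AN)))
      refl (Q (suc M)) (Q k) (poch q u k) (poch q v k) (poch q A m) (pow A k) (Q m) (poch q b k)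
           (poch q (c * q) k) (poch q A (suc M)) A c q (pow q k) (pow q m)
           (1# - A * pow q m) (1# - u * pow q k) (1# - v * pow q k) (1# - b * pow q k) (1# - q * pow q k)

  shiftFactor : ℕ → Carrier → Carrier → Carrier → Carrier → Carrier
  shiftFactor N a b w A = (1# - pow q N) * (1# - a) * (1# - w) * c / ((1# - b) * Δ N A)

  firstTerm : ℕ → Carrier → Carrier → Carrier → Carrier
  firstTerm N a b A = (a - b) * (d - c) * (1# - pow q N) / ((1# - b) * Δ N A)

  certificate : ℕ → Carrier → Carrier → ℕ → Carrier
  certificate N b A j =
    lhsTerm N b A j * (A * (1# - pow q (N ∸ j)) * (1# - u * pow q j) * (1# - v * pow q j))
      / ((1# - b * pow q j) * Δ N A)

  certificate-identity : ∀ {a b w A} → Admissible a b w A → ∀ X Z Y → Y ≈ X * Z →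
    (1# - b * X) * ((1# - c * Y) * (1# - A)) - (1# - a) * (1# - w) * c * X * (1# - Z)
    ≈ (1# - A * Z) * (1# - c * X) * (1# - b * X) - A * (1# - Z) * (1# - u * X) * (1# - v * X)
  certificate-identity {a} {b} {w} {A} adm X Z Y Y≈XZ = begin
    (1# - b * X) * ((1# - c * Y) * (1# - A)) - (1# - a) * (1# - w) * c * X * (1# - Z)
      ≈⟨ +-congˡ (-‿cong (solve 5 (λ a w c X Z →
           (𝟏 ⊖ a) ⊗ (𝟏 ⊖ w) ⊗ c ⊗ X ⊗ (𝟏 ⊖ Z) ⊜ (𝟏 ⊖ a) ⊗ X ⊗ (𝟏 ⊖ Z) ⊗ (c ⊖ w ⊗ c)) refl a w c X Z)) ⟩
    (1# - b * X) * ((1# - c * Y) * (1# - A)) - (1# - a) * X * (1# - Z) * (c - w * c)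
      ≈⟨ +-cong (*-congˡ (*-cong (+-congˡ (-‿cong (*-congˡ Y≈XZ))) (+-congˡ (-‿cong A≈ad))))
                (-‿cong (*-congˡ (+-congˡ (-‿cong wc≈bd)))) ⟩
    (1# - b * X) * ((1# - c * (X * Z)) * (1# - a * d)) - (1# - a) * X * (1# - Z) * (c - b * d)
      ≈⟨ solve 6 (λ a b c d X Z →
           (𝟏 ⊖ b ⊗ X) ⊗ ((𝟏 ⊖ c ⊗ (X ⊗ Z)) ⊗ (𝟏 ⊖ a ⊗ d)) ⊖ (𝟏 ⊖ a) ⊗ X ⊗ (𝟏 ⊖ Z) ⊗ (c ⊖ b ⊗ d)
           ⊜ (𝟏 ⊖ a ⊗ d ⊗ Z) ⊗ (𝟏 ⊖ c ⊗ X) ⊗ (𝟏 ⊖ b ⊗ X)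
             ⊖ (𝟏 ⊖ Z) ⊗ (a ⊗ d ⊖ b ⊗ d ⊗ X ⊖ a ⊗ c ⊗ X ⊕ b ⊗ c ⊗ X ⊗ X))
         refl a b c d X Z ⟩
    (1# - a * d * Z) * (1# - c * X) * (1# - b * X)
      - (1# - Z) * (a * d - b * d * X - a * c * X + b * c * X * X)
      ≈⟨ +-congˡ (-‿cong (*-congˡ (+-cong (+-cong (+-congˡ (-‿cong (*-congʳ (*-congʳ (sym ua≈b)))))
                                                  (-‿cong (*-congʳ (*-congˡ (sym vd≈c)))))
                                         (*-congʳ (*-congʳ (*-cong (sym ua≈b) (sym vd≈c))))))) ⟩
    (1# - a * d * Z) * (1# - c * X) * (1# - b * X)
      - (1# - Z) * (a * d - u * a * d * X - a * (v * d) * X + u * a * (v * d) * X * X)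
      ≈⟨ +-congˡ (-‿cong (solve 6 (λ a d u v X Z →
           (𝟏 ⊖ Z) ⊗ (a ⊗ d ⊖ u ⊗ a ⊗ d ⊗ X ⊖ a ⊗ (v ⊗ d) ⊗ X ⊕ u ⊗ a ⊗ (v ⊗ d) ⊗ X ⊗ X)
           ⊜ a ⊗ d ⊗ (𝟏 ⊖ Z) ⊗ (𝟏 ⊖ u ⊗ X) ⊗ (𝟏 ⊖ v ⊗ X))
         refl a d u v X Z)) ⟩
    (1# - a * d * Z) * (1# - c * X) * (1# - b * X) - a * d * (1# - Z) * (1# - u * X) * (1# - v * X)
      ≈⟨ sym (+-cong (*-congʳ (*-congʳ (+-congˡ (-‿cong (*-congʳ A≈ad)))))
                     (-‿cong (*-congʳ (*-congʳ (*-congʳ A≈ad))))) ⟩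
    (1# - A * Z) * (1# - c * X) * (1# - b * X) - A * (1# - Z) * (1# - u * X) * (1# - v * X)
      ∎
    where open Admissible adm

  certificate-top : ∀ N b A → certificate N b A N ≈ 0#
  certificate-top N b A =
    trans (*-congʳ (*-congˡ (*-congʳ (*-congʳ (*-congˡ 1-q^0≈0)))))
          (solve 5 (λ ℓ A x y i → ℓ ⊗ (A ⊗ Κ (+ 0) ⊗ x ⊗ y) ⊗ i ⊜ Κ (+ 0)) refl
                   (lhsTerm N b A N) A (1# - u * pow q N) (1# - v * pow q N) _)
    where
    1-q^0≈0 : 1# - pow q (N ∸ N) ≈ 0#
    1-q^0≈0 = trans (reflexive (≡.cong (λ j → 1# - pow q j) (ℕₚ.n∸n≡0 N))) (-‿inverseʳ 1#)

  certificate-step : ∀ {M k b A} → k ≤ M → Nondegenerate (suc M) b A →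
    certificate (suc M) b A k
    ≈ lhsTerm (suc M) b A (suc k) * ((1# - A * pow q (M ∸ k)) * (1# - c * pow q (suc k))) / Δ (suc M) A
  certificate-step {M} {k} {b} {A} k≤M nd = begin
    lhsTerm (suc M) b A k * s₀ / (β₀ * D)  ≈⟨ *-congʳ (lhsTerm-step k≤M nd) ⟩
    ℓ * (s * β₀) / (β₀ * D)                ≈⟨ /-cross (*-≉0 β₀≉0 (Δ≉0 nd)) (Δ≉0 nd)
                                                (solve 4 (λ ℓ s β D → ℓ ⊗ (s ⊗ β) ⊗ D ⊜ ℓ ⊗ s ⊗ (β ⊗ D)) refl ℓ s β₀ D) ⟩
    ℓ * s / D                              ∎
    where
    ℓ  = lhsTerm (suc M) b A (suc k)
    s₀ = A * (1# - pow q (suc M ∸ k)) * (1# - u * pow q k) * (1# - v * pow q k)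
    s  = (1# - A * pow q (M ∸ k)) * (1# - c * pow q (suc k))
    β₀ = 1# - b * pow q k
    D  = Δ (suc M) A
    β₀≉0 = poch-factor-≉0 (s≤s k≤M) (Nondegenerate.b≉0 nd)

  certificate-zero : ∀ {M a b w A} → Admissible a b w A → Nondegenerate (suc M) b A →
    certificate (suc M) b A 0 ≈ firstTerm (suc M) a b A
  certificate-zero {M} {a} {b} {w} {A} adm nd = begin
    lhsTerm (suc M) b A 0 * σ / ((1# - b * 1#) * D)  ≈⟨ *-congʳ (*-congʳ (lhsTerm-zero nd)) ⟩
    1# * σ / ((1# - b * 1#) * D)                     ≈⟨ /-cross (*-≉0 1-b*1≉0 (Δ≉0 nd)) (*-≉0 (1-b≉0 nd) (Δ≉0 nd)) cross ⟩
    (a - b) * (d - c) * (1# - Y) / ((1# - b) * D)    ∎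
    where
    open Admissible adm
    Y = pow q (suc M)
    D = Δ (suc M) A
    σ = A * (1# - Y) * (1# - u * 1#) * (1# - v * 1#)
    1-b*1≉0 = ≉0-resp-≈ (+-congˡ (-‿cong (sym (*-identityʳ b)))) (1-b≉0 nd)
    A[1-u][1-v]≈[a-b][d-c] : A * (1# - u) * (1# - v) ≈ (a - b) * (d - c)
    A[1-u][1-v]≈[a-b][d-c] = begin
      A * (1# - u) * (1# - v)      ≈⟨ *-congʳ (*-congʳ A≈ad) ⟩
      a * d * (1# - u) * (1# - v)  ≈⟨ solve 4 (λ a d u v → a ⊗ d ⊗ (𝟏 ⊖ u) ⊗ (𝟏 ⊖ v) ⊜ (a ⊖ u ⊗ a) ⊗ (d ⊖ v ⊗ d))
                                        refl a d u v ⟩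
      (a - u * a) * (d - v * d)    ≈⟨ *-cong (+-congˡ (-‿cong ua≈b)) (+-congˡ (-‿cong vd≈c)) ⟩
      (a - b) * (d - c)            ∎
    cross : 1# * σ * ((1# - b) * D) ≈ (a - b) * (d - c) * (1# - Y) * ((1# - b * 1#) * D)
    cross = begin
      1# * σ * ((1# - b) * D)
        ≈⟨ solve 6 (λ A Y u v b D → 𝟏 ⊗ (A ⊗ (𝟏 ⊖ Y) ⊗ (𝟏 ⊖ u ⊗ 𝟏) ⊗ (𝟏 ⊖ v ⊗ 𝟏)) ⊗ ((𝟏 ⊖ b) ⊗ D)
                                    ⊜ A ⊗ (𝟏 ⊖ u) ⊗ (𝟏 ⊖ v) ⊗ ((𝟏 ⊖ Y) ⊗ ((𝟏 ⊖ b ⊗ 𝟏) ⊗ D))) refl A Y u v b D ⟩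
      A * (1# - u) * (1# - v) * ((1# - Y) * ((1# - b * 1#) * D))
        ≈⟨ *-congʳ A[1-u][1-v]≈[a-b][d-c] ⟩
      (a - b) * (d - c) * ((1# - Y) * ((1# - b * 1#) * D))
        ≈⟨ sym (*-assoc _ _ _) ⟩
      (a - b) * (d - c) * (1# - Y) * ((1# - b * 1#) * D)
        ∎

  lhs-difference-< : ∀ {M k a b w A} → k < M → Admissible a b w A → Nondegenerate (suc M) b A →
    lhsTerm (suc M) b A (suc k) - shiftFactor (suc M) a b w A * lhsTerm M (b * q) (A * q) (suc k)
    ≈ certificate (suc M) b A k - certificate (suc M) b A (suc k)
  lhs-difference-< {M} {k} {a} {b} {w} {A} k<M adm nd = begin
    ℓ - K * ℓ′                   ≈⟨ +-congˡ (-‿cong shifted) ⟩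
    ℓ - ℓ * r / (β * D)          ≈⟨ x-x*r/y ℓ r βD≉0 ⟩
    ℓ * (β * D - r) / (β * D)    ≈⟨ *-congʳ (*-congˡ (certificate-identity adm X Z Y Y≈XZ)) ⟩
    ℓ * (s * β - t) / (β * D)    ≈⟨ x[yz-w]/zv≈xy/v-xw/zv ℓ s t β≉0 (Δ≉0 nd) ⟩
    ℓ * s / D - ℓ * t / (β * D)  ≈⟨ +-congʳ (sym (certificate-step (ℕₚ.<⇒≤ k<M) nd)) ⟩
    certificate (suc M) b A k - certificate (suc M) b A (suc k) ∎
    where
    X = pow q (suc k)
    Z = pow q (M ∸ k)
    Y = pow q (suc M)
    ℓ  = lhsTerm (suc M) b A (suc k)
    ℓ′ = lhsTerm M (b * q) (A * q) (suc k)
    K  = shiftFactor (suc M) a b w A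
    β  = 1# - b * X
    D  = Δ (suc M) A
    r  = (1# - a) * (1# - w) * c * X * (1# - Z)
    s  = (1# - A * Z) * (1# - c * X)
    t  = A * (1# - Z) * (1# - u * X) * (1# - v * X)
    Y≈XZ : Y ≈ X * Z
    Y≈XZ = trans (reflexive (≡.cong (pow q) (≡.sym (ℕₚ.m+[n∸m]≡n (s≤s (ℕₚ.<⇒≤ k<M))))))
                 (pow-+ q (suc k) (M ∸ k))
    β≉0 = poch-factor-≉0 (s≤s k<M) (Nondegenerate.b≉0 nd)
    βD≉0 = *-≉0 β≉0 (Δ≉0 nd)
    [1-b]D≉0 = *-≉0 (1-b≉0 nd) (Δ≉0 nd)
    [1-Y]β≉0 = *-≉0 (1-q^N≉0 nd) β≉0
    shifted : K * ℓ′ ≈ ℓ * r / (β * D)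
    shifted = begin
      K * ℓ′
        ≈⟨ *-congˡ (*≈⇒≈/ [1-Y]β≉0 (lhsTerm-shift k<M nd)) ⟩
      K * (ℓ * (X * (1# - Z) * (1# - b)) / ((1# - Y) * β))
        ≈⟨ trans (sym (*-assoc _ _ _)) (/-*-/ _ _ [1-b]D≉0 [1-Y]β≉0) ⟩
      (1# - Y) * (1# - a) * (1# - w) * c * (ℓ * (X * (1# - Z) * (1# - b))) / ((1# - b) * D * ((1# - Y) * β))
        ≈⟨ /-cross (*-≉0 [1-b]D≉0 [1-Y]β≉0) βD≉0
             (solve 10 (λ Y a w c ℓ X Z b β D →
                (𝟏 ⊖ Y) ⊗ (𝟏 ⊖ a) ⊗ (𝟏 ⊖ w) ⊗ c ⊗ (ℓ ⊗ (X ⊗ (𝟏 ⊖ Z) ⊗ (𝟏 ⊖ b))) ⊗ (β ⊗ D)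
                ⊜ ℓ ⊗ ((𝟏 ⊖ a) ⊗ (𝟏 ⊖ w) ⊗ c ⊗ X ⊗ (𝟏 ⊖ Z)) ⊗ ((𝟏 ⊖ b) ⊗ D ⊗ ((𝟏 ⊖ Y) ⊗ β)))
              refl Y a w c ℓ X Z b β D) ⟩
      ℓ * r / (β * D)
        ∎

  -- At n = N the factor 1 - b q^N of the certificate's denominator may vanish; there the
  -- shifted term is out of range and the certificate vanishes instead.
  lhs-difference-top : ∀ {M a b w A} → Nondegenerate (suc M) b A →
    lhsTerm (suc M) b A (suc M) - shiftFactor (suc M) a b w A * lhsTerm M (b * q) (A * q) (suc M)
    ≈ certificate (suc M) b A M - certificate (suc M) b A (suc M)
  lhs-difference-top {M} {a} {b} {w} {A} nd = begin
    ℓ - K * lhsTerm M (b * q) (A * q) (suc M)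
      ≈⟨ +-congˡ (-‿cong (*-congˡ (lhsTerm-out-of-range M (b * q) (A * q)))) ⟩
    ℓ - K * 0#
      ≈⟨ +-cong ℓ≈certificate (-‿cong (trans (zeroʳ K) (sym (certificate-top (suc M) b A)))) ⟩
    certificate (suc M) b A M - certificate (suc M) b A (suc M)
      ∎
    where
    ℓ = lhsTerm (suc M) b A (suc M)
    K = shiftFactor (suc M) a b w A
    D = Δ (suc M) A
    s = (1# - A * pow q (M ∸ M)) * (1# - c * pow q (suc M))
    Aq^0≈A : A * pow q (M ∸ M) ≈ A
    Aq^0≈A = trans (*-congˡ (reflexive (≡.cong (pow q) (ℕₚ.n∸n≡0 M)))) (*-identityʳ A)
    ℓ≈certificate : ℓ ≈ certificate (suc M) b A M
    ℓ≈certificate = begin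
      ℓ          ≈⟨ sym (/-cancelˡ ℓ (Δ≉0 nd)) ⟩
      ℓ * D / D  ≈⟨ *-congʳ (*-congˡ (trans (*-comm _ _) (*-congʳ (+-congˡ (-‿cong (sym Aq^0≈A)))))) ⟩
      ℓ * s / D  ≈⟨ sym (certificate-step ℕₚ.≤-refl nd) ⟩
      certificate (suc M) b A M ∎

  lhs-difference : ∀ {M k a b w A} → k ≤ M → Admissible a b w A → Nondegenerate (suc M) b A →
    lhsTerm (suc M) b A (suc k) - shiftFactor (suc M) a b w A * lhsTerm M (b * q) (A * q) (suc k)
    ≈ certificate (suc M) b A k - certificate (suc M) b A (suc k)
  lhs-difference k≤M adm nd with ℕₚ.m≤n⇒m<n∨m≡n k≤M
  ... | inj₁ k<M    = lhs-difference-< k<M adm nd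
  ... | inj₂ ≡.refl = lhs-difference-top nd

  lhs-recurrence : ∀ {M a b w A} → Admissible a b w A → Nondegenerate (suc M) b A →
    sum1 (suc M) (lhsTerm (suc M) b A)
    ≈ firstTerm (suc M) a b A + shiftFactor (suc M) a b w A * sum1 M (lhsTerm M (b * q) (A * q))
  lhs-recurrence {M} {a} {b} {w} {A} adm nd = begin
    sum1 (suc M) L                            ≈⟨ solve 3 (λ s k t → s ⊜ (s ⊖ k ⊗ t) ⊕ k ⊗ t) refl _ K _ ⟩
    (sum1 (suc M) L - K * ΣL′) + K * ΣL′       ≈⟨ +-cong telescoped (*-congˡ ΣL′≈) ⟩
    firstTerm (suc M) a b A + K * sum1 M L′   ∎
    where
    L  = lhsTerm (suc M) b A
    L′ = lhsTerm M (b * q) (A * q)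
    K  = shiftFactor (suc M) a b w A
    h  = certificate (suc M) b A
    ΣL′ = sum1 (suc M) L′
    ΣL′≈ : ΣL′ ≈ sum1 M L′
    ΣL′≈ = trans (+-congˡ (lhsTerm-out-of-range M (b * q) (A * q))) (+-identityʳ _)
    difference : ∀ n → 1 ≤ n → n ≤ suc M → L n - K * L′ n ≈ h (n ∸ 1) - h n
    difference (suc k) _ (s≤s k≤M) = lhs-difference k≤M adm nd
    telescoped : sum1 (suc M) L - K * ΣL′ ≈ firstTerm (suc M) a b A
    telescoped = begin
      sum1 (suc M) L - K * ΣL′               ≈⟨ +-congˡ (-‿cong (*-distribˡ-sum1 (suc M) K L′)) ⟩
      sum1 (suc M) L - sum1 (suc M) (λ n → K * L′ n)
                                            ≈⟨ sym (sum1-− (suc M) L (λ n → K * L′ n)) ⟩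
      sum1 (suc M) (λ n → L n - K * L′ n)    ≈⟨ sum1-cong (suc M) difference ⟩
      sum1 (suc M) (λ n → h (n ∸ 1) - h n)   ≈⟨ sum1-telescope (suc M) h ⟩
      h 0 - h (suc M)                        ≈⟨ +-cong (certificate-zero adm nd) (-‿cong (certificate-top (suc M) b A)) ⟩
      firstTerm (suc M) a b A - 0#           ≈⟨ x-0≈x _ ⟩
      firstTerm (suc M) a b A                ∎

  rhsTerm : ℕ → Carrier → Carrier → Carrier → Carrier → ℕ → Carrier
  rhsTerm N a b w A zero    = 0#
  rhsTerm N a b w A (suc k) =
    (a - b) * (d - c)
      * (qbinom q N (suc k) * (poch q a k * poch q w k * Q (suc k) * poch q (c * q) (N ∸ suc k) * pow c k * pow q k)
           / (poch q b (suc k) * poch q (c * q) N * poch q A (suc k)))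

  rhsDenominator-≉0 : ∀ {N k r b A} → suc k ≤ N → N ∸ suc k ≡ r → Nondegenerate N b A →
    Q (suc k) * Q r * (poch q b (suc k) * poch q (c * q) N * poch q A (suc k)) ≉ 0#
  rhsDenominator-≉0 {N} {k} k<N ≡.refl nd =
    *-≉0 (*-≉0 (poch-≉0-≤ k<N Q≉0) (poch-≉0-≤ (ℕₚ.m∸n≤m N (suc k)) Q≉0))
         (*-≉0 (*-≉0 (poch-≉0-≤ k<N b≉0) cq≉0) (poch-≉0-≤ k<N A≉0))
    where open Nondegenerate nd

  rhsTerm-normal : ∀ {N k r a b w A} → suc k ≤ N → N ∸ suc k ≡ r → Nondegenerate N b A →
    rhsTerm N a b w A (suc k)
    ≈ (a - b) * (d - c) * (Q N * (poch q a k * poch q w k * Q (suc k) * poch q (c * q) r * pow c k * pow q k))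
        / (Q (suc k) * Q r * (poch q b (suc k) * poch q (c * q) N * poch q A (suc k)))
  rhsTerm-normal {N} {k} k<N ≡.refl nd rewrite qbinom-≤ q k<N =
    trans (*-congˡ (/-*-/ (Q N) _ (*≉0⇒≉0ˡ D≉0) (*≉0⇒≉0ʳ D≉0))) (sym (*-assoc _ _ _))
    where D≉0 = rhsDenominator-≉0 k<N ≡.refl nd

  rhsTerm-first : ∀ {M a b} w {A} → Nondegenerate (suc M) b A → rhsTerm (suc M) a b w A 1 ≈ firstTerm (suc M) a b A
  rhsTerm-first {M} {a} {b} w {A} nd =
    trans (rhsTerm-normal {w = w} (s≤s z≤n) ≡.refl nd)
          (/-cross (rhsDenominator-≉0 (s≤s z≤n) ≡.refl nd) (*-≉0 (1-b≉0 nd) (Δ≉0 nd))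
            (solve 9 (λ a b c d q QM y CM A →
                (a ⊖ b) ⊗ (d ⊖ c) ⊗ (QM ⊗ (𝟏 ⊖ q ⊗ y) ⊗ (𝟏 ⊗ 𝟏 ⊗ (𝟏 ⊗ (𝟏 ⊖ q ⊗ 𝟏)) ⊗ CM ⊗ 𝟏 ⊗ 𝟏))
                  ⊗ ((𝟏 ⊖ b) ⊗ ((𝟏 ⊖ c ⊗ (y ⊗ q)) ⊗ (𝟏 ⊖ A)))
                ⊜ (a ⊖ b) ⊗ (d ⊖ c) ⊗ (𝟏 ⊖ y ⊗ q)
                  ⊗ (𝟏 ⊗ (𝟏 ⊖ q ⊗ 𝟏) ⊗ QM ⊗ (𝟏 ⊗ (𝟏 ⊖ b ⊗ 𝟏) ⊗ (CM ⊗ (𝟏 ⊖ c ⊗ q ⊗ y)) ⊗ (𝟏 ⊗ (𝟏 ⊖ A ⊗ 𝟏)))))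
              refl a b c d q (Q M) (pow q M) (poch q (c * q) M) A))

  rhsTerm-shift : ∀ {M k a b w A} → suc k ≤ M → Nondegenerate (suc M) b A →
    rhsTerm (suc M) a b w A (suc (suc k))
    ≈ shiftFactor (suc M) a b w A * rhsTerm M (a * q) (b * q) (w * q) (A * q) (suc k)
  rhsTerm-shift {M} {k} {a} {b} {w} {A} k<M nd = begin
    rhsTerm (suc M) a b w A (suc (suc k))
      ≈⟨ rhsTerm-normal (s≤s k<M) ≡.refl nd ⟩
    P₁ / D₁
      ≈⟨ /-cross D₁≉0 (*-≉0 KD≉0 D₂≉0) cross ⟩
    κ * P₂ / (KD * D₂)
      ≈⟨ sym (trans (*-congˡ (rhsTerm-normal k<M ≡.refl (nondegenerate-shift nd)))
                    (trans (sym (*-assoc _ _ _)) (/-*-/ κ P₂ KD≉0 D₂≉0))) ⟩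
    shiftFactor (suc M) a b w A * rhsTerm M (a * q) (b * q) (w * q) (A * q) (suc k)
      ∎
    where
    r  = M ∸ suc k
    κ  = (1# - pow q (suc M)) * (1# - a) * (1# - w) * c
    KD = (1# - b) * Δ (suc M) A
    P₁ = (a - b) * (d - c) * (Q (suc M) * (poch q a (suc k) * poch q w (suc k) * Q (suc (suc k))
                                             * poch q (c * q) r * pow c (suc k) * pow q (suc k)))
    D₁ = Q (suc (suc k)) * Q r * (poch q b (suc (suc k)) * poch q (c * q) (suc M) * poch q A (suc (suc k)))
    P₂ = (a * q - b * q) * (d - c) * (Q M * (poch q (a * q) k * poch q (w * q) k * Q (suc k)
                                               * poch q (c * q) r * pow c k * pow q k))
    D₂ = Q (suc k) * Q r * (poch q (b * q) (suc k) * poch q (c * q) M * poch q (A * q) (suc k))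
    P₁′ = (a - b) * (d - c) * (Q (suc M) * ((1# - a) * poch q (a * q) k * ((1# - w) * poch q (w * q) k)
                                              * Q (suc (suc k)) * poch q (c * q) r * pow c (suc k) * pow q (suc k)))
    D₁′ = Q (suc (suc k)) * Q r
            * ((1# - b) * poch q (b * q) (suc k) * poch q (c * q) (suc M) * ((1# - A) * poch q (A * q) (suc k)))
    G  = (d - c) * Q M * (1# - a) * poch q (a * q) k * (1# - w) * poch q (w * q) k * Q (suc k) * Q (suc k)
           * (1# - q * pow q (suc k)) * poch q (c * q) r * pow c k * c * pow q k * (1# - b) * (1# - A) * Q r
           * poch q (b * q) (suc k) * poch q (c * q) M * poch q (A * q) (suc k)
    D₁≉0 = rhsDenominator-≉0 (s≤s k<M) ≡.refl nd
    D₂≉0 = rhsDenominator-≉0 k<M ≡.refl (nondegenerate-shift nd)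
    KD≉0 = *-≉0 (1-b≉0 nd) (Δ≉0 nd)
    -- The factor G common to both sides is separated by commutative-monoid normalisation,
    -- leaving only four factors for the ring solver.
    cross : P₁ * (KD * D₂) ≈ κ * P₂ * D₁
    cross = begin
      P₁ * (KD * D₂)
        ≈⟨ *-congʳ (*-congˡ (*-congˡ (*-congʳ (*-congʳ (*-congʳ (*-congʳ
             (*-cong (poch-unfoldˡ q a k) (poch-unfoldˡ q w k)))))))) ⟩
      P₁′ * (KD * D₂)
        ≈⟨ CM.solve 22 (λ amb dmc QM qy oa aqk ow wqk Qk Qk₂ Cr ck c x q ob cN oA Qr bq1 CM Aq1 →
             amb ⊙ dmc ⊙ (QM ⊙ qy ⊙ (oa ⊙ aqk ⊙ (ow ⊙ wqk) ⊙ (Qk ⊙ Qk₂) ⊙ Cr ⊙ (ck ⊙ c) ⊙ (x ⊙ q)))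
               ⊙ (ob ⊙ (cN ⊙ oA) ⊙ (Qk ⊙ Qr ⊙ (bq1 ⊙ CM ⊙ Aq1)))
             ≋ (dmc ⊙ QM ⊙ oa ⊙ aqk ⊙ ow ⊙ wqk ⊙ Qk ⊙ Qk ⊙ Qk₂ ⊙ Cr ⊙ ck ⊙ c ⊙ x ⊙ ob ⊙ oA ⊙ Qr ⊙ bq1 ⊙ CM ⊙ Aq1)
               ⊙ (amb ⊙ qy ⊙ q ⊙ cN))
           refl (a - b) (d - c) (Q M) (1# - q * pow q M) (1# - a) (poch q (a * q) k) (1# - w) (poch q (w * q) k)
                (Q (suc k)) (1# - q * pow q (suc k)) (poch q (c * q) r) (pow c k) c (pow q k) q (1# - b)
                (1# - c * pow q (suc M)) (1# - A) (Q r) (poch q (b * q) (suc k)) (poch q (c * q) M)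
                (poch q (A * q) (suc k)) ⟩
      G * ((a - b) * (1# - q * pow q M) * q * (1# - c * pow q (suc M)))
        ≈⟨ *-congˡ (solve 5 (λ a b c q y →
             (a ⊖ b) ⊗ (𝟏 ⊖ q ⊗ y) ⊗ q ⊗ (𝟏 ⊖ c ⊗ (y ⊗ q)) ⊜ (𝟏 ⊖ y ⊗ q) ⊗ (a ⊗ q ⊖ b ⊗ q) ⊗ (𝟏 ⊖ c ⊗ q ⊗ y))
           refl a b c q (pow q M)) ⟩
      G * ((1# - pow q (suc M)) * (a * q - b * q) * (1# - c * q * pow q M))
        ≈⟨ CM.solve 21 (λ yq oa ow c aqbq dmc QM aqk wqk Qk Cr ck x Qk₂ Qr ob bq1 CM cqy oA Aq1 →
             (dmc ⊙ QM ⊙ oa ⊙ aqk ⊙ ow ⊙ wqk ⊙ Qk ⊙ Qk ⊙ Qk₂ ⊙ Cr ⊙ ck ⊙ c ⊙ x ⊙ ob ⊙ oA ⊙ Qr ⊙ bq1 ⊙ CM ⊙ Aq1)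
               ⊙ (yq ⊙ aqbq ⊙ cqy)
             ≋ yq ⊙ oa ⊙ ow ⊙ c ⊙ (aqbq ⊙ dmc ⊙ (QM ⊙ (aqk ⊙ wqk ⊙ Qk ⊙ Cr ⊙ ck ⊙ x)))
               ⊙ (Qk ⊙ Qk₂ ⊙ Qr ⊙ (ob ⊙ bq1 ⊙ (CM ⊙ cqy) ⊙ (oA ⊙ Aq1))))
           refl (1# - pow q (suc M)) (1# - a) (1# - w) c (a * q - b * q) (d - c) (Q M) (poch q (a * q) k)
                (poch q (w * q) k) (Q (suc k)) (poch q (c * q) r) (pow c k) (pow q k) (1# - q * pow q (suc k))
                (Q r) (1# - b) (poch q (b * q) (suc k)) (poch q (c * q) M) (1# - c * q * pow q M) (1# - A)
                (poch q (A * q) (suc k)) ⟩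
      κ * P₂ * D₁′
        ≈⟨ *-congˡ (*-congˡ (*-cong (*-congʳ (sym (poch-unfoldˡ q b (suc k)))) (sym (poch-unfoldˡ q A (suc k))))) ⟩
      κ * P₂ * D₁
        ∎

  rhs-recurrence : ∀ {M a b w A} → Nondegenerate (suc M) b A →
    sum1 (suc M) (rhsTerm (suc M) a b w A)
    ≈ firstTerm (suc M) a b A + shiftFactor (suc M) a b w A * sum1 M (rhsTerm M (a * q) (b * q) (w * q) (A * q))
  rhs-recurrence {M} {a} {b} {w} {A} nd = begin
    sum1 (suc M) R                                     ≈⟨ sum1-unfoldˡ M R ⟩
    R 1 + sum1 M (λ n → R (suc n))                     ≈⟨ +-cong (rhsTerm-first w nd) (sum1-cong M shifted) ⟩
    firstTerm (suc M) a b A + sum1 M (λ n → K * R′ n)  ≈⟨ +-congˡ (sym (*-distribˡ-sum1 M K R′)) ⟩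
    firstTerm (suc M) a b A + K * sum1 M R′            ∎
    where
    R  = rhsTerm (suc M) a b w A
    R′ = rhsTerm M (a * q) (b * q) (w * q) (A * q)
    K  = shiftFactor (suc M) a b w A
    shifted : ∀ n → 1 ≤ n → n ≤ M → R (suc n) ≈ K * R′ n
    shifted (suc k) _ k<M = rhsTerm-shift k<M nd

  lhs≈rhs : ∀ N {a b w A} → Admissible a b w A → Nondegenerate N b A →
    sum1 N (lhsTerm N b A) ≈ sum1 N (rhsTerm N a b w A)
  lhs≈rhs zero    _   _  = refl
  lhs≈rhs (suc M) {a} {b} {w} {A} adm nd = begin
    sum1 (suc M) (lhsTerm (suc M) b A)
      ≈⟨ lhs-recurrence adm nd ⟩
    firstTerm (suc M) a b A + K * sum1 M (lhsTerm M (b * q) (A * q))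
      ≈⟨ +-congˡ (*-congˡ (lhs≈rhs M (admissible-shift adm) (nondegenerate-shift nd))) ⟩
    firstTerm (suc M) a b A + K * sum1 M (rhsTerm M (a * q) (b * q) (w * q) (A * q))
      ≈⟨ sym (rhs-recurrence nd) ⟩
    sum1 (suc M) (rhsTerm (suc M) a b w A)
      ∎
    where K = shiftFactor (suc M) a b w A

  rhsTerm-as-difference : ∀ {N k a b w A} → suc k ≤ N → Nondegenerate N b A → A - b ≉ 0# →
    rhsTerm N a b w A (suc k)
    ≈ (a - b) * (d - c) / (A - b)
        * (qbinom q N (suc k) * (poch q a k * poch q w k * Q (suc k) * poch q (c * q) (N ∸ suc k) * pow c k)
             / (poch q b k * poch q (c * q) N * poch q A k)
             * (A * pow q k / (1# - A * pow q k) - b * pow q k / (1# - b * pow q k)))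
  rhsTerm-as-difference {N} {k} {a} {b} {w} {A} k<N nd A-b≉0 = sym (begin
    ab / (A - b) * (B * X / Y * (A * x / α - b * x / β))
      ≈⟨ *-congˡ (*-congˡ (/---/ (A * x) (b * x) α≉0 β≉0)) ⟩
    ab / (A - b) * (B * X / Y * ((A * x * β - b * x * α) / (α * β)))
      ≈⟨ *-congˡ (*-congˡ (*-congʳ (solve 3 (λ A x b →
           A ⊗ x ⊗ (𝟏 ⊖ b ⊗ x) ⊖ b ⊗ x ⊗ (𝟏 ⊖ A ⊗ x) ⊜ (A ⊖ b) ⊗ x) refl A x b))) ⟩
    ab / (A - b) * (B * X / Y * ((A - b) * x / (α * β)))
      ≈⟨ *-congˡ (trans (sym (*-assoc _ _ _)) (/-*-/ (B * X) _ Y≉0 αβ≉0)) ⟩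
    ab / (A - b) * (B * X * ((A - b) * x) / (Y * (α * β)))
      ≈⟨ trans (sym (*-assoc _ _ _)) (/-*-/ ab _ A-b≉0 (*-≉0 Y≉0 αβ≉0)) ⟩
    ab * (B * X * ((A - b) * x)) / ((A - b) * (Y * (α * β)))
      ≈⟨ /-cross (*-≉0 A-b≉0 (*-≉0 Y≉0 αβ≉0)) Y′≉0
           (solve 11 (λ ab B X A b x Bk CN Ak α β →
              ab ⊗ (B ⊗ X ⊗ ((A ⊖ b) ⊗ x)) ⊗ (Bk ⊗ β ⊗ CN ⊗ (Ak ⊗ α))
              ⊜ ab ⊗ (B ⊗ (X ⊗ x)) ⊗ ((A ⊖ b) ⊗ (Bk ⊗ CN ⊗ Ak ⊗ (α ⊗ β))))
            refl ab B X A b x (poch q b k) (poch q (c * q) N) (poch q A k) α β) ⟩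
    ab * (B * (X * x)) / Y′
      ≈⟨ *-assoc _ _ _ ⟩
    ab * (B * (X * x) / Y′)
      ∎)
    where
    open Nondegenerate nd
    k≤N = ℕₚ.<⇒≤ k<N
    ab = (a - b) * (d - c)
    B  = qbinom q N (suc k)
    x  = pow q k
    X  = poch q a k * poch q w k * Q (suc k) * poch q (c * q) (N ∸ suc k) * pow c k
    Y  = poch q b k * poch q (c * q) N * poch q A k
    Y′ = poch q b (suc k) * poch q (c * q) N * poch q A (suc k)
    α  = 1# - A * x
    β  = 1# - b * x
    α≉0 = poch-factor-≉0 k<N A≉0
    β≉0 = poch-factor-≉0 k<N b≉0
    αβ≉0 = *-≉0 α≉0 β≉0
    Y≉0 = *-≉0 (*-≉0 (poch-≉0-≤ k≤N b≉0) cq≉0) (poch-≉0-≤ k≤N A≉0)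
    Y′≉0 = *-≉0 (*-≉0 (poch-≉0-≤ k<N b≉0) cq≉0) (poch-≉0-≤ k<N A≉0)

theorem2p1 : ∀ {ℓc ℓe : Level} (F : Field ℓc ℓe) →
  let open Field F
      open FieldDefs F
  in (q a b c d : Carrier) (N : ℕ) →
     ¬ (a ≈ 0#) → ¬ (c ≈ 0#) → ¬ (d ≈ 0#) → ¬ (a * d - b ≈ 0#) →
     ¬ (poch q q N ≈ 0#) → ¬ (poch q b N ≈ 0#) →
     ¬ (poch q (c * q) N ≈ 0#) → ¬ (poch q (a * d) N ≈ 0#) →
     sum1 N (λ n →
       qbinom q N n
         * (poch q q n * poch q (b / a) n * poch q (c / d) n
            * poch q (a * d) (N ∸ n) * pow (a * d) n)
         / (poch q b n * poch q (c * q) n * poch q (a * d) N))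
     ≈
     ((a - b) * (d - c) / (a * d - b))
       * sum1 N (λ n →
           qbinom q N n
             * (poch q a (n ∸ 1) * poch q (b * d / c) (n ∸ 1) * poch q q n
                * poch q (c * q) (N ∸ n) * pow c (n ∸ 1))
             / (poch q b (n ∸ 1) * poch q (c * q) N * poch q (a * d) (n ∸ 1))
             * (a * d * pow q (n ∸ 1) / (1# - a * d * pow q (n ∸ 1))
                - b * pow q (n ∸ 1) / (1# - b * pow q (n ∸ 1))))
theorem2p1 F q a b c d N a≉0 c≉0 d≉0 ad-b≉0 Q≉0 b≉0 cq≉0 ad≉0 =
  trans (lhs≈rhs N admissible nondegenerate)
        (trans (sum1-cong N (λ { (suc k) _ k<N → rhsTerm-as-difference k<N nondegenerate ad-b≉0 }))
               (sym (*-distribˡ-sum1 N _ _)))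
  where
  open Field F
  open FieldDefs F
  open FieldProperties F
  open Sum1Properties F
  open Recurrence F q c d (b / a) (c / d)
  admissible : Admissible a b (b * d / c) (a * d)
  admissible = record
    { ua≈b  = /-cancelʳ b a≉0
    ; vd≈c  = /-cancelʳ c d≉0
    ; wc≈bd = /-cancelʳ (b * d) c≉0
    ; A≈ad  = refl
    }
  nondegenerate : Nondegenerate N b (a * d)
  nondegenerate = record { Q≉0 = Q≉0 ; b≉0 = b≉0 ; cq≉0 = cq≉0 ; A≉0 = ad≉0 }
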